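{- If $G$ is a finite simple $2$-connected graph whose periphery has cardinality at least $2$, then $G$ contains a set $S$ of $2$ peripheral vertices such that $G-S$ is connected.
   Context: The eccentricity of a vertex $v$ of a connected graph $G$ is the largest distance from $v$ to a vertex of $G$. A vertex is peripheral if its eccentricity equals the diameter of $G$; the periphery of $G$ is the set of all peripheral vertices. -}

module Defs where

open import Data.Nat using (ℕ; zero; suc; _≤_)
open import Data.Fin using (Fin)
open import Data.Bool using (Bool; true; false)
open import Data.Product using (Σ; ∃; _×_; _,_)
open import Relation.Binary.PropositionalEquality using (_≡_; _≢_)
open import Relation.Nullary using (¬_)
open import Data.Unit using (⊤; tt)

record Graph (n : ℕ) : Set where
  field
    adj       : Fin n → Fin n → Bool
    adj-sym   : ∀ u v → adj u v ≡ adj v u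
    adj-irrfl : ∀ v → adj v v ≡ false

open Graph public

module _ {n : ℕ} (G : Graph n) where

  Adj : Fin n → Fin n → Set
  Adj u v = adj G u v ≡ true

  data WalkIn (P : Fin n → Set) : Fin n → Fin n → ℕ → Set where
    here : ∀ {v} → P v → WalkIn P v v zero
    step : ∀ {u w v k} → P u → Adj u w → WalkIn P w v k → WalkIn P u v (suc k)

  Walk : Fin n → Fin n → ℕ → Set
  Walk = WalkIn (λ _ → ⊤)

  ConnectedOn : (Fin n → Set) → Set
  ConnectedOn P = ∀ u v → P u → P v → ∃ λ k → WalkIn P u v k

  Connected : Set
  Connected = ∀ u v → ∃ λ k → Walk u v k

  TwoConnected : Set
  TwoConnected = 3 ≤ n × Connected × (∀ x → ConnectedOn (λ w → w ≢ x))

  Dist : Fin n → Fin n → ℕ → Set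
  Dist u v d = Walk u v d × (∀ k → Walk u v k → d ≤ k)

  Ecc : Fin n → ℕ → Set
  Ecc v e = (∀ u d → Dist v u d → d ≤ e) × (∃ λ u → Dist v u e)

  Diam : ℕ → Set
  Diam D = (∀ v e → Ecc v e → e ≤ D) × (∃ λ v → Ecc v D)

  Peripheral : Fin n → Set
  Peripheral v = ∃ λ e → ∃ λ D → Ecc v e × Diam D × e ≡ D

{-# OPTIONS --safe #-}
-- Let u, v be at distance D = diam G and z the
-- neighbour of u on a shortest u–v walk.  If every vertex of G − {u, v} is joined
-- to z inside G − {u, v}, the pair {u, v} works.  Otherwise, from a vertex x that
-- is not, climb inside G − {u, v} along increasing distance to u until a local
-- maximum q is reached.  Every vertex other than v and q then has a neighbour
-- closer to u which is neither v (v is farthest from u) nor q (that would be a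
-- higher neighbour of q), so G − {v, q} is connected.  And q is peripheral: if
-- d(q, u) < D, the vertex t on the geodesic from z to v with d(t, v) = d(q, u)
-- lies in the component of z, so every q–t walk passes through u or v and, by the
-- triangle inequality, has length at least D.

module Submission where

open import Defs
open import Data.Nat using (ℕ; zero; suc; _+_; _∸_; _≤_; _<_; _<?_; s≤s)
open import Data.Nat.Properties
open import Data.Nat.Induction using (<-rec)
open import Data.Fin using (Fin) renaming (_≟_ to _≟ᶠ_)
open import Data.Fin.Properties using (any?; all?; ¬∀⟶∃¬)
open import Data.List using (allFin)
open import Data.List.Extrema.Nat using (argmax; f[xs]≤f[argmax])
open import Data.List.Membership.Propositional.Properties using (∈-allFin)
import Data.List.Relation.Unary.All as All
open import Data.Bool using (true)
open import Data.Bool.Properties using () renaming (_≟_ to _≟ᵇ_)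
open import Data.Product using (∃; _×_; _,_; proj₁; proj₂)
open import Data.Sum using (_⊎_; inj₁; inj₂)
open import Data.Unit using (tt)
open import Data.Empty using (⊥-elim)
open import Function using (_∘_)
open import Relation.Nullary using (¬_; Dec; yes; no; contradiction)
open import Relation.Nullary.Decidable using (_×-dec_; ¬?; _→-dec_)
open import Relation.Unary using (Pred; Decidable)
open import Relation.Binary.PropositionalEquality
  using (_≡_; _≢_; refl; sym; trans; cong; subst)

least-witness : {P : Pred ℕ _} → Decidable P → ∀ {k} → P k →
                ∃ λ m → P m × (∀ {j} → P j → m ≤ j)
least-witness {P} P? {k} = <-rec Least search k
  where
  Least : ℕ → Set
  Least k = P k → ∃ λ m → P m × (∀ {j} → P j → m ≤ j)

  search : ∀ k → (∀ {j} → j < k → Least j) → Least k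
  search k smaller pk with anyUpTo? P? k
  ... | yes (j , j<k , pj) = smaller j<k pj
  ... | no none            = k , pk , λ pj → ≮⇒≥ (λ j<k → none (_ , j<k , pj))

module Walks {n : ℕ} (G : Graph n) where

  Vertex : Set
  Vertex = Fin n

  private variable
    P : Pred Vertex _
    a b c : Vertex
    k l : ℕ

  Adj-sym : Adj G a b → Adj G b a
  Adj-sym {a} {b} e = trans (adj-sym G b a) e

  adj? : ∀ a b → Dec (Adj G a b)
  adj? a b = adj G a b ≟ᵇ true

  source : WalkIn G P a b k → P a
  source (here p)     = p
  source (step p _ _) = p

  _++_ : WalkIn G P a b k → WalkIn G P b c l → WalkIn G P a c (k + l)
  here _     ++ w′ = w′
  step p e w ++ w′ = step p e (w ++ w′)

  reverse : WalkIn G P a b k → WalkIn G P b a k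
  reverse (here p) = here p
  reverse {k = suc k} (step p e w) =
    subst (WalkIn G _ _ _) (+-comm k 1) (reverse w ++ step (source w) (Adj-sym e) (here p))

  splitAt : ∀ k → WalkIn G P a b (k + l) → ∃ λ c → WalkIn G P a c k × WalkIn G P c b l
  splitAt zero    w            = _ , here (source w) , w
  splitAt (suc k) (step p e w) with splitAt k w
  ... | c , w₁ , w₂ = c , step p e w₁ , w₂

  walk₀⇒≡ : WalkIn G P a b 0 → a ≡ b
  walk₀⇒≡ (here _) = refl

  walk? : Decidable P → ∀ a b k → Dec (WalkIn G P a b k)
  walk? P? a b zero with a ≟ᶠ b | P? a
  ... | yes refl | yes p  = yes (here p)
  ... | yes refl | no ¬p  = no λ { (here p) → ¬p p }
  ... | no a≢b   | _      = no λ { (here _) → a≢b refl }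
  walk? P? a b (suc k) with P? a | any? (λ w → adj? a w ×-dec walk? P? w b k)
  ... | yes p | yes (_ , e , w) = yes (step p e w)
  ... | no ¬p | _               = no λ { (step p _ _) → ¬p p }
  ... | yes _ | no none         = no λ { (step _ e w) → none (_ , e , w) }

  LocalMax : (Vertex → ℕ) → Pred Vertex _ → Vertex → Set
  LocalMax f P q = ∀ w → Adj G q w → P w → f w ≤ f q

  climb : (f : Vertex → ℕ) {B : ℕ} → (∀ x → f x ≤ B) → Decidable P →
          ∀ fuel {x} → B ≤ f x + fuel → P x →
          ∃ λ q → P q × LocalMax f P q × ∃ λ c → WalkIn G P x q c × c + f x ≤ f q
  climb f bound P? fuel {x} room px with any? (λ w → adj? x w ×-dec P? w ×-dec f x <? f w)
  ... | no noHigher =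
    x , px , (λ w e pw → ≮⇒≥ (λ fx<fw → noHigher (w , e , pw , fx<fw))) , 0 , here px , ≤-refl
  climb f {B} bound P? zero {x} room px | yes (w , _ , _ , fx<fw) =
    ⊥-elim (<⇒≱ fx<fw (≤-trans (bound w) (subst (B ≤_) (+-identityʳ (f x)) room)))
  climb f {B} bound P? (suc fuel) {x} room px | yes (w , e , pw , fx<fw)
    with climb f bound P? fuel (≤-trans room (subst (_≤ f w + fuel) (sym (+-suc (f x) fuel)) (+-monoˡ-≤ fuel fx<fw))) pw
  ... | q , pq , max , c , wq , gain =
    q , pq , max , suc c , step px e wq ,
    ≤-trans (subst (_≤ c + f w) (+-suc c (f x)) (+-monoʳ-≤ c fx<fw)) gain

module Distance {n : ℕ} (G : Graph n) (connected : Connected G) where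
  open Walks G

  private variable
    P : Pred Vertex _
    a b c q t x : Vertex
    k D : ℕ

  abstract
    shortest : ∀ a b → ∃ (Dist G a b)
    shortest a b with least-witness (walk? (λ _ → yes tt) a b) (proj₂ (connected a b))
    ... | d , w , least = d , w , λ _ → least

  δ : Vertex → Vertex → ℕ
  δ a b = proj₁ (shortest a b)

  δ-Dist : Dist G a b (δ a b)
  δ-Dist {a} {b} = proj₂ (shortest a b)

  δ-walk : Walk G a b (δ a b)
  δ-walk = proj₁ δ-Dist

  δ-least : Walk G a b k → δ a b ≤ k
  δ-least = proj₂ δ-Dist _

  Dist⇒δ≡ : ∀ {d} → Dist G a b d → δ a b ≡ d
  Dist⇒δ≡ (w , least) = ≤-antisym (δ-least w) (least _ δ-walk)

  δ-refl : δ a a ≡ 0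
  δ-refl = n≤0⇒n≡0 (δ-least (here tt))

  δ≡0⇒≡ : δ a b ≡ 0 → a ≡ b
  δ≡0⇒≡ eq = walk₀⇒≡ (subst (Walk G _ _) eq δ-walk)

  δ-sym : δ a b ≡ δ b a
  δ-sym = ≤-antisym (δ-least (reverse δ-walk)) (δ-least (reverse δ-walk))

  δ-triangle : ∀ b → δ a c ≤ δ a b + δ b c
  δ-triangle _ = δ-least (δ-walk ++ δ-walk)

  δ-step : Adj G a x → δ a b ≤ suc (δ x b)
  δ-step e = δ-least (step tt e δ-walk)

  δ-parent : a ≢ b → ∃ λ y → Adj G a y × suc (δ y b) ≡ δ a b
  δ-parent {a} {b} a≢b with δ a b in eq | δ-walk {a} {b}
  ... | zero  | w          = contradiction (walk₀⇒≡ w) a≢b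
  ... | suc d | step _ e w =
    _ , e , ≤-antisym (s≤s (δ-least w)) (subst (_≤ suc (δ _ b)) eq (δ-step e))

  geodesic-point : ∀ i {j} → δ a b ≡ i + j → ∃ λ t → δ a t ≡ i × δ t b ≡ j
  geodesic-point {a} {b} i {j} ab with splitAt i (subst (Walk G a b) ab δ-walk)
  ... | t , w₁ , w₂ = t , ≤-antisym (δ-least w₁) i≤ , ≤-antisym (δ-least w₂) j≤
    where
    tight : i + j ≤ δ a t + δ t b
    tight = subst (_≤ δ a t + δ t b) ab (δ-triangle t)
    i≤ : i ≤ δ a t
    i≤ = +-cancelʳ-≤ j i (δ a t) (≤-trans tight (+-monoʳ-≤ (δ a t) (δ-least w₂)))
    j≤ : j ≤ δ t b
    j≤ = +-cancelˡ-≤ i j (δ t b) (≤-trans tight (+-monoˡ-≤ (δ t b) (δ-least w₁)))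

  farthest : ∀ a → ∃ λ t → ∀ b → δ a b ≤ δ a t
  farthest a = argmax (δ a) a (allFin n) ,
               λ b → All.lookup (f[xs]≤f[argmax] {f = δ a} a (allFin n)) (∈-allFin b)

  δ≤diam : Diam G D → δ a b ≤ D
  δ≤diam {a = a} {b} (ecc≤D , _) with farthest a
  ... | t , far = ≤-trans (far b) (ecc≤D a (δ a t) (ecc , t , δ-Dist))
    where
    ecc : ∀ y d → Dist G a y d → d ≤ δ a t
    ecc y d dist = subst (_≤ δ a t) (Dist⇒δ≡ dist) (far y)

  peripheral : Diam G D → δ q t ≡ D → Peripheral G q
  peripheral {D} {t = t} diam qt =
    D , D , ((λ _ _ dist → subst (_≤ D) (Dist⇒δ≡ dist) (δ≤diam diam)) , t , subst (Dist G _ t) qt δ-Dist) ,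
    diam , refl

  stays⊎leaves : Decidable P → Walk G a b k →
                 WalkIn G P a b k ⊎ ∃ λ s → ¬ P s × δ a s + δ s b ≤ k
  stays⊎leaves {a = a} P? w with P? a
  stays⊎leaves P? w | no ¬pa = inj₂ (_ , ¬pa , +-mono-≤ (δ-least (here tt)) (δ-least w))
  stays⊎leaves P? (here _) | yes pa = inj₁ (here pa)
  stays⊎leaves P? (step _ e w) | yes pa with stays⊎leaves P? w
  ... | inj₁ w′ = inj₁ (step pa e w′)
  ... | inj₂ (s , ¬ps , short) = inj₂ (s , ¬ps , ≤-trans (+-monoˡ-≤ (δ s _) (δ-step e)) (s≤s short))

  connectedOn-descending : ∀ {r} →
    (∀ {x} → P x → x ≢ r → ∃ λ y → Adj G x y × P y × δ y r < δ x r) → ConnectedOn G P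
  connectedOn-descending {P} {r} descend a b pa pb =
    let ka , wa = toRoot _ ≤-refl pa
        kb , wb = toRoot _ ≤-refl pb
    in ka + kb , wa ++ reverse wb
    where
    toRoot : ∀ fuel {x} → δ x r < suc fuel → P x → ∃ λ k → WalkIn G P x r k
    toRoot fuel {x} _ px with x ≟ᶠ r
    ... | yes refl = 0 , here px
    toRoot zero       (s≤s x≤0)    px | no x≢r with descend px x≢r
    ... | _ , _ , _ , closer = contradiction (≤-trans closer x≤0) λ ()
    toRoot (suc fuel) (s≤s x≤fuel) px | no x≢r with descend px x≢r
    ... | _ , e , py , closer with toRoot fuel (≤-trans closer x≤fuel) py
    ...   | k , w = suc k , step px e w

module PeripheralPair {n : ℕ} (G : Graph n) (connected : Connected G) where
  open Walks G
  open Distance G connected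

  NonSeparatingPeripheralPair : Set
  NonSeparatingPeripheralPair = ∃ λ a → ∃ λ b → a ≢ b × Peripheral G a × Peripheral G b ×
    ConnectedOn G (λ w → w ≢ a × w ≢ b)

  module _ {D : ℕ} (diam : Diam G D) {u v : Vertex} (uv : δ u v ≡ D) (D≢0 : D ≢ 0) where

    Avoiding : Pred Vertex _
    Avoiding w = w ≢ u × w ≢ v

    avoiding? : Decidable Avoiding
    avoiding? w = ¬? (w ≟ᶠ u) ×-dec ¬? (w ≟ᶠ v)

    ¬Avoiding : ∀ {s} → ¬ Avoiding s → s ≡ u ⊎ s ≡ v
    ¬Avoiding {s} ¬avoid with s ≟ᶠ u | s ≟ᶠ v
    ... | yes s≡u | _       = inj₁ s≡u
    ... | no _    | yes s≡v = inj₂ s≡v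
    ... | no s≢u  | no s≢v  = contradiction (s≢u , s≢v) ¬avoid

    u≢v : u ≢ v
    u≢v refl = D≢0 (trans (sym uv) δ-refl)

    vu : δ v u ≡ D
    vu = trans (sym δ-sym) uv

    connected-without-localMax : ∀ {q} → LocalMax (λ w → δ w u) Avoiding q →
                                 ConnectedOn G (λ w → w ≢ v × w ≢ q)
    connected-without-localMax {q} max = connectedOn-descending towards-u
      where
      towards-u : ∀ {x} → x ≢ v × x ≢ q → x ≢ u →
                  ∃ λ y → Adj G x y × (y ≢ v × y ≢ q) × δ y u < δ x u
      towards-u {x} (x≢v , _) x≢u with δ-parent x≢u
      ... | y , xy , closer = y , xy , (y≢v , y≢q) , ≤-reflexive closer
        where
        y≢v : y ≢ v
        y≢v refl = <⇒≱ (≤-reflexive closer) (subst (δ x u ≤_) (sym vu) (δ≤diam diam))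
        y≢q : y ≢ q
        y≢q refl = <⇒≱ (≤-reflexive closer) (max x (Adj-sym xy) (x≢u , x≢v))

    pivot : ∃ λ z → suc (δ z v) ≡ D
    pivot with δ-parent u≢v
    ... | z , _ , zv = z , trans zv uv

    z : Vertex
    z = proj₁ pivot

    -- Bounded so as to be decidable; length 3D suffices for the walk built in diametral-to-point.
    Near : Pred Vertex _
    Near x = ∃ λ k → k < suc (D + (D + D)) × WalkIn G Avoiding z x k

    near? : Decidable Near
    near? x = anyUpTo? (walk? avoiding? z x) (suc (D + (D + D)))

    point-at-distance : ∀ m {β} → β ≢ 0 → m + β ≡ δ z v →
      ∃ λ t → δ t v ≡ β × D ≤ δ u t + β × WalkIn G Avoiding z t (δ z t)
    point-at-distance m {β} β≢0 m+β≡zv with geodesic-point m (sym m+β≡zv)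
    ... | t , zt , tv = t , tv , far-from-u , z⇝t
      where
      open ≤-Reasoning
      far-from-u : D ≤ δ u t + β
      far-from-u = begin
        D                  ≡⟨ sym uv ⟩
        δ u v              ≤⟨ δ-triangle t ⟩
        δ u t + δ t v      ≡⟨ cong (δ u t +_) tv ⟩
        δ u t + β          ∎
      z⇝t : WalkIn G Avoiding z t (δ z t)
      z⇝t with stays⊎leaves avoiding? (δ-walk {z} {t})
      ... | inj₁ w = w
      ... | inj₂ (s , ¬avoid , detour) with ¬Avoiding ¬avoid
      ...   | inj₁ refl = contradiction far-from-u (<⇒≱ (begin-strict
                δ u t + β          ≤⟨ +-monoˡ-≤ β (≤-trans (m≤n+m _ (δ z u)) (≤-trans detour (≤-reflexive zt))) ⟩
                m + β              ≡⟨ m+β≡zv ⟩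
                δ z v              <⟨ ≤-reflexive (proj₂ pivot) ⟩
                D                  ∎))
      ...   | inj₂ refl = contradiction (≤-trans detour (≤-reflexive zt)) (<⇒≱ (begin-strict
                m                  <⟨ m<m+n m (n≢0⇒n>0 β≢0) ⟩
                m + β              ≡⟨ m+β≡zv ⟩
                δ z v              ≤⟨ m≤m+n _ _ ⟩
                δ z v + δ v t      ∎))

    δzv-split : ∀ {β} → β < D → (δ z v ∸ β) + β ≡ δ z v
    δzv-split β<D = m∸n+n≡m (≤-pred (subst (suc _ ≤_) (sym (proj₂ pivot)) β<D))

    diametral-to-point : ∀ {x q c t} → ¬ Near x → WalkIn G Avoiding x q c → c ≤ D →
      δ t v ≡ δ q u → D ≤ δ u t + δ q u → WalkIn G Avoiding z t (δ z t) → D ≤ δ q t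
    diametral-to-point {q = q} {t = t} far xq c≤D tv far-from-u z⇝t
      with stays⊎leaves avoiding? (δ-walk {q} {t})
    ... | inj₁ q⇝t = contradiction
            (_ , s≤s (+-mono-≤ (δ≤diam diam) (+-mono-≤ (δ≤diam diam) c≤D)) , z⇝t ++ (reverse q⇝t ++ reverse xq))
            far
    ... | inj₂ (s , ¬avoid , detour) with ¬Avoiding ¬avoid
    ...   | inj₁ refl = begin
              D                  ≤⟨ far-from-u ⟩
              δ u t + δ q u      ≡⟨ +-comm (δ u t) _ ⟩
              δ q u + δ u t      ≤⟨ detour ⟩
              δ q t              ∎
      where open ≤-Reasoning
    ...   | inj₂ refl = begin
              D                  ≡⟨ sym uv ⟩
              δ u v              ≤⟨ δ-triangle q ⟩
              δ u q + δ q v      ≡⟨ cong (_+ δ q v) (trans δ-sym (trans (sym tv) δ-sym)) ⟩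
              δ v t + δ q v      ≡⟨ +-comm (δ v t) _ ⟩
              δ q v + δ v t      ≤⟨ detour ⟩
              δ q t              ∎
      where open ≤-Reasoning

    far-peripheral : ∀ {x q c} → ¬ Near x → Avoiding q → WalkIn G Avoiding x q c → c ≤ D →
                     Peripheral G q
    far-peripheral {q = q} far (q≢u , _) xq c≤D with δ q u ≟ D
    ... | yes qu = peripheral diam qu
    ... | no qu≢D =
      let t , tv , far-from-u , z⇝t = point-at-distance _ (q≢u ∘ δ≡0⇒≡) (δzv-split (≤∧≢⇒< (δ≤diam diam) qu≢D))
      in peripheral diam (≤-antisym (δ≤diam diam) (diametral-to-point far xq c≤D tv far-from-u z⇝t))

    near⊎far : (∀ x → Avoiding x → Near x) ⊎ ∃ λ x → Avoiding x × ¬ Near x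
    near⊎far with all? (λ x → avoiding? x →-dec near? x)
    ... | yes all-near = inj₁ all-near
    ... | no some-far with ¬∀⟶∃¬ n _ (λ x → avoiding? x →-dec near? x) some-far
    ...   | x , ¬near-if-avoiding with avoiding? x
    ...     | yes ax = inj₂ (x , ax , λ near → ¬near-if-avoiding (λ _ → near))
    ...     | no ¬ax = contradiction (λ ax → contradiction ax ¬ax) ¬near-if-avoiding

    non-separating-pair : NonSeparatingPeripheralPair
    non-separating-pair with near⊎far
    ... | inj₁ all-near = u , v , u≢v , peripheral diam uv , peripheral diam vu , via-z
      where
      via-z : ConnectedOn G Avoiding
      via-z a b pa pb =
        let _ , _ , za = all-near a pa
            _ , _ , zb = all-near b pb
        in _ , reverse za ++ zb
    ... | inj₂ (x , ax , far) =
      let q , aq , max , c , xq , gain = climb (λ w → δ w u) (λ _ → δ≤diam diam) avoiding? D (m≤n+m D (δ x u)) ax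
          c≤D = ≤-trans (m≤m+n c _) (≤-trans gain (δ≤diam diam))
      in v , q , proj₂ aq ∘ sym , peripheral diam vu , far-peripheral far aq xq c≤D ,
         connected-without-localMax max

mainTheorem3 : ∀ {n : ℕ} (G : Graph n) → TwoConnected G →
    (∃ λ u → ∃ λ v → u ≢ v × Peripheral G u × Peripheral G v) →
    ∃ λ u → ∃ λ v → u ≢ v × Peripheral G u × Peripheral G v ×
      ConnectedOn G (λ w → w ≢ u × w ≢ v)
mainTheorem3 G (_ , connected , _) (u , u′ , u≢u′ , (_ , D , (_ , _ , uv) , diam , refl) , _) =
  non-separating-pair diam (Dist⇒δ≡ uv) D≢0
  where
  open Distance G connected
  open PeripheralPair G connected
  D≢0 : D ≢ 0
  D≢0 refl = u≢u′ (δ≡0⇒≡ (n≤0⇒n≡0 (δ≤diam diam)))
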